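{- Let $\mathcal{T}=(T,\mathsf{bag})$ be a regular tree decomposition of a graph $G$ of adhesion $a$. Then $$\sum_{x\in V(T)} |\mathsf{bgraph}(x)|\leq (a+2)|G|\qquad\textrm{and}\qquad \sum_{x\in V(T)} \|\mathsf{bgraph}(x)\|\leq \|G\|+(a+2)^2|G|.$$
   Context: $|G|=|V(G)|$, $\|G\|=|V(G)|+|E(G)|$. A tree decomposition $\mathcal T=(T,\mathsf{bag})$ of $G$ consists of a rooted tree $T$ and $\mathsf{bag}:V(T)\to 2^{V(G)}$ such that for each vertex $u$ the nodes whose bags contain $u$ induce a nonempty connected subtree, and each edge of $G$ lies in some bag. For a node $x$ with parent $p$ (and $\mathsf{bag}(p)=\emptyset$ if $x$ is the root): $\mathsf{adh}(x)=\mathsf{bag}(p)\cap\mathsf{bag}(x)$; $\mathsf{mrg}(x)=\mathsf{bag}(x)\setminus\mathsf{adh}(x)$; $\mathsf{cone}(x)$ is the union of bags of all descendants of $x$ (including $x$); $\mathsf{comp}(x)=\mathsf{cone}(x)\setminus\mathsf{adh}(x)$. The adhesion of $\mathcal T$ is $\max_x|\mathsf{adh}(x)|$. $\mathcal T$ is regular if for every non-root node $x$: $\mathsf{mrg}(x)\neq\emptyset$, $G[\mathsf{comp}(x)]$ is connected, and every vertex of $\mathsf{adh}(x)$ has a neighbor in $\mathsf{comp}(x)$. The bag graph $\mathsf{bgraph}(x)$ has vertex set the disjoint union of $\mathsf{bag}(x)$ and the set of children of $x$; two vertices $u,v\in\mathsf{bag}(x)$ are adjacent iff adjacent in $G$;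 $u\in\mathsf{bag}(x)$ and a child $y$ are adjacent iff $u$ has a neighbor in $\mathsf{comp}(y)$; no two children are adjacent. -}

module Defs where

open import Data.Nat using (ℕ; zero; suc; _+_; _≤_; _⊔_)
open import Data.Bool using (Bool; true; false; _∧_; _∨_; not)
open import Data.Fin using (Fin; zero; suc; toℕ; _≟_; _<?_)
open import Data.List using (List; length; filterᵇ; map; foldr; allFin)
open import Data.Nat.ListAction using (sum)
open import Data.Bool.ListAction using (any)
open import Data.Product using (Σ; ∃; _×_; _,_)
open import Data.Sum using (_⊎_)
open import Relation.Binary.PropositionalEquality using (_≡_)
open import Relation.Nullary.Decidable using (⌊_⌋)

count : ∀ {k} → (Fin k → Bool) → ℕ
count {k} S = length (filterᵇ S (allFin k))

anyFin : ∀ {k} → (Fin k → Bool) → Bool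
anyFin {k} S = any S (allFin k)

sumFin : ∀ {k} → (Fin k → ℕ) → ℕ
sumFin {k} f = sum (map f (allFin k))

maxFin : ∀ {k} → (Fin k → ℕ) → ℕ
maxFin {k} f = foldr _⊔_ 0 (map f (allFin k))

eqᵇ : ∀ {k} → Fin k → Fin k → Bool
eqᵇ x y = ⌊ x ≟ y ⌋

ltᵇ : ∀ {k} → Fin k → Fin k → Bool
ltᵇ x y = ⌊ x <? y ⌋

record Graph : Set where
  field
    n      : ℕ
    adj    : Fin n → Fin n → Bool
    sym    : ∀ u v → adj u v ≡ adj v u
    irrefl : ∀ u → adj u u ≡ false

module _ (G : Graph) where
  open Graph G

  order : ℕ
  order = n

  edgeCount : ℕ
  edgeCount = sumFin {n} (λ u → count {n} (λ v → ltᵇ u v ∧ adj u v))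

  size : ℕ
  size = order + edgeCount

  data GWalk (S : Fin n → Bool) : Fin n → Fin n → Set where
    gnil  : ∀ {u} → S u ≡ true → GWalk S u u
    gcons : ∀ {u v w} → S u ≡ true → adj u v ≡ true → GWalk S v w → GWalk S u w

  Connected : (Fin n → Bool) → Set
  Connected S = ∀ u v → S u ≡ true → S v ≡ true → GWalk S u v

-- Nodes are Fin (suc m); node zero is the root and node
-- (suc i) has parent (par i), which has a smaller index.  (Every finite
-- rooted tree can be labelled this way, e.g. in BFS order.)

record RootedTree : Set where
  field
    m      : ℕ
    par    : Fin m → Fin (suc m)
    par-lt : ∀ i → toℕ (par i) ≤ toℕ i

module _ (T : RootedTree) where
  open RootedTree T

  Node : Set
  Node = Fin (suc m)

  data TAdj : Node → Node → Set where
    up   : ∀ i → TAdj (suc i) (par i)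
    down : ∀ i → TAdj (par i) (suc i)

  data TWalk (S : Node → Bool) : Node → Node → Set where
    tnil  : ∀ {x} → S x ≡ true → TWalk S x x
    tcons : ∀ {x y z} → S x ≡ true → TAdj x y → TWalk S y z → TWalk S x z

  ConnectedSubtree : (Node → Bool) → Set
  ConnectedSubtree S =
    (∃ λ x → S x ≡ true) × (∀ x y → S x ≡ true → S y ≡ true → TWalk S x y)

  -- descendant test with fuel (depth of y is at most toℕ y)
  descF : ℕ → Node → Node → Bool
  descF zero    y x = false
  descF (suc f) zero    x = eqᵇ zero x
  descF (suc f) (suc i) x = eqᵇ (suc i) x ∨ descF f (par i) x

  -- y is a descendant of x (including y = x)
  isDesc : Node → Node → Bool
  isDesc y x = descF (suc (toℕ y)) y x

  isChild : Node → Node → Bool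
  isChild zero    x = false
  isChild (suc i) x = eqᵇ (par i) x

record TreeDecomposition (G : Graph) : Set where
  open Graph G
  field
    tree : RootedTree
    bag  : Node tree → Fin n → Bool
    vertex-subtree : ∀ u → ConnectedSubtree tree (λ x → bag x u)
    edge-covered   : ∀ u v → adj u v ≡ true →
                     ∃ λ x → bag x u ≡ true × bag x v ≡ true

module TD {G : Graph} (𝒯 : TreeDecomposition G) where
  open Graph G
  open TreeDecomposition 𝒯
  open RootedTree tree

  adh : Node tree → Fin n → Bool
  adh zero    u = false
  adh (suc i) u = bag (par i) u ∧ bag (suc i) u

  mrg : Node tree → Fin n → Bool
  mrg x u = bag x u ∧ not (adh x u)

  cone : Node tree → Fin n → Bool
  cone x u = anyFin (λ y → isDesc tree y x ∧ bag y u)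

  comp : Node tree → Fin n → Bool
  comp x u = cone x u ∧ not (adh x u)

  adhesion : ℕ
  adhesion = maxFin (λ x → count (adh x))

  Regular : Set
  Regular = ∀ (i : Fin m) →
      (∃ λ u → mrg (suc i) u ≡ true)
    × Connected G (comp (suc i))
    × (∀ u → adh (suc i) u ≡ true →
         ∃ λ v → comp (suc i) v ≡ true × adj u v ≡ true)

  -- bag graph bgraph(x): vertices bag(x) ⊎ children(x)
  hasNbrIn : Fin n → (Fin n → Bool) → Bool
  hasNbrIn u S = anyFin (λ v → adj u v ∧ S v)

  bgOrder : Node tree → ℕ
  bgOrder x = count (bag x) + count (λ y → isChild tree y x)

  bgEdges : Node tree → ℕ
  bgEdges x =
      sumFin (λ u → count (λ v → bag x u ∧ bag x v ∧ ltᵇ u v ∧ adj u v))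
    + sumFin (λ u → count (λ y → bag x u ∧ isChild tree y x ∧ hasNbrIn u (comp y)))

  bgSize : Node tree → ℕ
  bgSize x = bgOrder x + bgEdges x

-- Every vertex u of G lies in mrg(x) for exactly one node x, the topmost node
-- whose bag contains u, so Σ |mrg(x)| ≤ |G|; as regularity makes mrg(x)
-- nonempty for non-root x, T has at most |G| non-root nodes.  Since
-- bag(x) = mrg(x) ∪ adh(x), |adh(x)| ≤ a and every non-root node is the child
-- of exactly one node, Σ |bgraph(x)| ≤ |G| + a|G| + |G|.  An edge of G inside
-- bag(x) has its smaller endpoint in mrg(x) (charged to that endpoint: at most
-- |E(G)| such edges in total) or lies in adh(x) × mrg(x) or adh(x) × adh(x).
-- If u ∈ bag(x) has a neighbour in comp(y) for a child y, that edge lies in a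
-- bag below y, so u ∈ adh(y) by the subtree property: there are at most a|G|
-- bag–child edges.
module Submission where

open import Defs
open import Data.Nat using (ℕ; zero; suc; _+_; _*_; _≤_; _<_; _⊔_; z≤n; s≤s)
open import Data.Nat.Properties
  using ( +-*-semiring; ≤-refl; ≤-reflexive; ≤-trans; ≤-antisym; <⇒≱; n≤1+n
        ; m≤m+n; m≤n+m; +-mono-≤; +-monoˡ-≤; +-monoʳ-≤; *-mono-≤; *-monoˡ-≤; *-monoʳ-≤
        ; +-identityʳ; *-identityˡ; *-identityʳ; m≤m⊔n; m≤n⊔m; module ≤-Reasoning)
open import Data.Nat.Solver using (module +-*-Solver)
import Data.Nat.ListAction as ListAction
open import Data.Bool using (Bool; true; false; _∧_; _∨_; not)
open import Data.Fin using (Fin; zero; suc; toℕ; _≟_)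
open import Data.Fin.Properties using (toℕ-injective; suc-injective; 0≢1+n)
open import Data.List as List using (List; []; _∷_; length; filterᵇ; allFin)
open import Data.List.Properties using (map-tabulate)
open import Data.Bool.ListAction using (any)
import Data.Vec.Functional as Vector
open import Algebra.Properties.Semiring.Sum +-*-semiring
  using (sum; sum-syntax; sum-cong-≗; sum-replicate-zero; ∑-distrib-+; ∑-comm
        ; *-distribˡ-sum; *-distribʳ-sum)
open import Data.Product using (∃; _×_; _,_; proj₁; proj₂)
open import Data.Empty using (⊥; ⊥-elim)
open import Function using (_∘_; id)
open import Relation.Binary.PropositionalEquality
  using (_≡_; refl; sym; trans; cong; cong₂; subst; module ≡-Reasoning)
open import Relation.Nullary using (yes; no)

∧-≡-true⁻ : ∀ {a b} → a ∧ b ≡ true → a ≡ true × b ≡ true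
∧-≡-true⁻ {true} {true} _ = refl , refl

∧-≡-true⁺ : ∀ {a b} → a ≡ true → b ≡ true → a ∧ b ≡ true
∧-≡-true⁺ refl refl = refl

∨-≡-trueˡ : ∀ {a b} → a ∨ b ≡ true → b ≡ false → a ≡ true
∨-≡-trueˡ {true}  _ _ = refl
∨-≡-trueˡ {false} refl ()

∨-≡-trueʳ : ∀ a {b} → b ≡ true → a ∨ b ≡ true
∨-≡-trueʳ true  _ = refl
∨-≡-trueʳ false h = h

∧-not-≡-true : ∀ {a b} → a ∧ not b ≡ true → b ≡ true → ⊥
∧-not-≡-true {true} {true} () _

eqᵇ-refl : ∀ {k} (x : Fin k) → eqᵇ x x ≡ true
eqᵇ-refl x with x ≟ x
... | yes _ = refl
... | no x≢x = ⊥-elim (x≢x refl)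

eqᵇ-sound : ∀ {k} {x y : Fin k} → eqᵇ x y ≡ true → x ≡ y
eqᵇ-sound {x = x} {y} h with x ≟ y
... | yes x≡y = x≡y

any-witness : ∀ {A : Set} (p : A → Bool) (xs : List A) → any p xs ≡ true → ∃ λ x → p x ≡ true
any-witness p (x ∷ xs) h with p x in px
... | true  = x , px
... | false = any-witness p xs h

𝟙 : Bool → ℕ
𝟙 true  = 1
𝟙 false = 0

card : ∀ {k} → (Fin k → Bool) → ℕ
card S = sum (𝟙 ∘ S)

AtMostOne : ∀ {k} → (Fin k → Bool) → Set
AtMostOne p = ∀ i j → p i ≡ true → p j ≡ true → i ≡ j

𝟙-∧ : ∀ a b → 𝟙 (a ∧ b) ≡ 𝟙 a * 𝟙 b
𝟙-∧ true  b = sym (+-identityʳ (𝟙 b))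
𝟙-∧ false b = refl

𝟙-mono : ∀ {a b} → (a ≡ true → b ≡ true) → 𝟙 a ≤ 𝟙 b
𝟙-mono {false} h = z≤n
𝟙-mono {true}  h rewrite h refl = ≤-refl

𝟙-∧-not-split : ∀ b a → 𝟙 b ≤ 𝟙 (b ∧ not a) + 𝟙 a
𝟙-∧-not-split true  true  = ≤-refl
𝟙-∧-not-split true  false = ≤-refl
𝟙-∧-not-split false a     = z≤n

sum-mono-≤ : ∀ {k} {f g : Fin k → ℕ} → (∀ i → f i ≤ g i) → sum f ≤ sum g
sum-mono-≤ {zero}  h = z≤n
sum-mono-≤ {suc k} h = +-mono-≤ (h zero) (sum-mono-≤ (h ∘ suc))

sum-≤-* : ∀ {k c} {f : Fin k → ℕ} → (∀ i → f i ≤ c) → sum f ≤ k * c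
sum-≤-* {zero}  h = z≤n
sum-≤-* {suc k} h = +-mono-≤ (h zero) (sum-≤-* (h ∘ suc))

sum-≤-pred-* : ∀ {k c} (f : Fin (suc k) → ℕ) →
               f zero ≡ 0 → (∀ i → f (suc i) ≤ c) → sum f ≤ k * c
sum-≤-pred-* f f₀≡0 h rewrite f₀≡0 = sum-≤-* h

*-≤-sum : ∀ {k c} {f : Fin k → ℕ} → (∀ i → c ≤ f i) → k * c ≤ sum f
*-≤-sum {zero}  h = z≤n
*-≤-sum {suc k} h = +-mono-≤ (h zero) (*-≤-sum (h ∘ suc))

sum-≤-+ : ∀ {k} {f g h : Fin k → ℕ} → (∀ i → f i ≤ g i + h i) → sum f ≤ sum g + sum h
sum-≤-+ {g = g} {h} p = ≤-trans (sum-mono-≤ p) (≤-reflexive (∑-distrib-+ g h))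

∑-distrib-+₃ : ∀ {k} (f g h : Fin k → ℕ) → ∑[ i < k ] (f i + g i + h i) ≡ sum f + sum g + sum h
∑-distrib-+₃ f g h = trans (∑-distrib-+ (λ i → f i + g i) h) (cong (_+ sum h) (∑-distrib-+ f g))

sum-≤-+₃ : ∀ {k} {f g h l : Fin k → ℕ} → (∀ i → f i ≤ g i + h i + l i) →
           sum f ≤ sum g + sum h + sum l
sum-≤-+₃ {g = g} {h} {l} p = ≤-trans (sum-mono-≤ p) (≤-reflexive (∑-distrib-+₃ g h l))

≤-sum : ∀ {k} (f : Fin k → ℕ) i → f i ≤ sum f
≤-sum f zero    = m≤m+n (f zero) _
≤-sum f (suc i) = ≤-trans (≤-sum (f ∘ suc) i) (m≤n+m _ (f zero))

card-empty : ∀ {k} {p : Fin k → Bool} → (∀ i → p i ≡ true → ⊥) → card p ≡ 0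
card-empty {zero}          h = refl
card-empty {suc k} {p} h with p zero in p₀
... | true  = ⊥-elim (h zero p₀)
... | false = card-empty {p = p ∘ suc} (h ∘ suc)

card-≤1 : ∀ {k} {p : Fin k → Bool} → AtMostOne p → card p ≤ 1
card-≤1 {zero}          u = z≤n
card-≤1 {suc k} {p} u with p zero in p₀
... | true  = ≤-reflexive (cong suc (card-empty (λ j pj → 0≢1+n (u zero (suc j) p₀ pj))))
... | false = card-≤1 {p = p ∘ suc} (λ i j pi pj → suc-injective (u (suc i) (suc j) pi pj))

sum-𝟙-* : ∀ {k} (p : Fin k → Bool) (c : ℕ) → ∑[ i < k ] (𝟙 (p i) * c) ≡ card p * c
sum-𝟙-* p c = sym (*-distribʳ-sum c (𝟙 ∘ p))

card-≤1-* : ∀ {k} {p : Fin k → Bool} {c} → AtMostOne p → card p * c ≤ c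
card-≤1-* {c = c} u = ≤-trans (*-monoˡ-≤ c (card-≤1 u)) (≤-reflexive (*-identityˡ c))

card-nonempty : ∀ {k} {p : Fin k → Bool} {i} → p i ≡ true → 1 ≤ card p
card-nonempty {p = p} {i} pi = subst (_≤ card p) (cong 𝟙 pi) (≤-sum (𝟙 ∘ p) i)

card-× : ∀ {k l} (p : Fin k → Bool) (q : Fin l → Bool) →
         ∑[ i < k ] ∑[ j < l ] 𝟙 (p i ∧ q j) ≡ card p * card q
card-× p q = begin
  ∑[ i < _ ] ∑[ j < _ ] 𝟙 (p i ∧ q j)     ≡⟨ sum-cong-≗ (λ i → sum-cong-≗ (λ j → 𝟙-∧ (p i) (q j))) ⟩
  ∑[ i < _ ] ∑[ j < _ ] (𝟙 (p i) * 𝟙 (q j)) ≡⟨ sum-cong-≗ (λ i → sym (*-distribˡ-sum (𝟙 (p i)) (𝟙 ∘ q))) ⟩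
  ∑[ i < _ ] (𝟙 (p i) * card q)          ≡⟨ sum-𝟙-* p (card q) ⟩
  card p * card q                        ∎
  where open ≡-Reasoning

foldr-tabulate : ∀ {A B : Set} (g : A → B → B) (e : B) {k} (f : Fin k → A) →
                 List.foldr g e (List.tabulate f) ≡ Vector.foldr g e f
foldr-tabulate g e {zero}  f = refl
foldr-tabulate g e {suc k} f = cong (g (f zero)) (foldr-tabulate g e (f ∘ suc))

foldr-map-allFin : ∀ {B : Set} (g : ℕ → B → B) (e : B) {k} (f : Fin k → ℕ) →
                   List.foldr g e (List.map f (allFin k)) ≡ Vector.foldr g e f
foldr-map-allFin g e f = trans (cong (List.foldr g e) (map-tabulate id f)) (foldr-tabulate g e f)

sumFin≡sum : ∀ {k} (f : Fin k → ℕ) → sumFin f ≡ sum f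
sumFin≡sum = foldr-map-allFin _+_ 0

length-filterᵇ : ∀ {A : Set} (p : A → Bool) (xs : List A) →
                 length (filterᵇ p xs) ≡ ListAction.sum (List.map (𝟙 ∘ p) xs)
length-filterᵇ p []       = refl
length-filterᵇ p (x ∷ xs) with p x
... | true  = cong suc (length-filterᵇ p xs)
... | false = length-filterᵇ p xs

count≡card : ∀ {k} (S : Fin k → Bool) → count S ≡ card S
count≡card {k} S = trans (length-filterᵇ S (allFin k)) (sumFin≡sum (𝟙 ∘ S))

sumFin-+ : ∀ {k} (f g : Fin k → ℕ) → sumFin (λ i → f i + g i) ≡ sumFin f + sumFin g
sumFin-+ f g = begin
  sumFin (λ i → f i + g i)  ≡⟨ sumFin≡sum (λ i → f i + g i) ⟩
  sum (λ i → f i + g i)     ≡⟨ ∑-distrib-+ f g ⟩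
  sum f + sum g             ≡⟨ cong₂ _+_ (sumFin≡sum f) (sumFin≡sum g) ⟨
  sumFin f + sumFin g       ∎
  where open ≡-Reasoning

sumFin-count≡sum-card : ∀ {k l} (P : Fin k → Fin l → Bool) →
                        sumFin (λ i → count (P i)) ≡ ∑[ i < k ] card (P i)
sumFin-count≡sum-card P = trans (sumFin≡sum (λ i → count (P i))) (sum-cong-≗ (λ i → count≡card (P i)))

≤-foldr-⊔ : ∀ {k} (f : Fin k → ℕ) i → f i ≤ Vector.foldr _⊔_ 0 f
≤-foldr-⊔ f zero    = m≤m⊔n (f zero) _
≤-foldr-⊔ f (suc i) = ≤-trans (≤-foldr-⊔ (f ∘ suc) i) (m≤n⊔m (f zero) _)

≤-maxFin : ∀ {k} (f : Fin k → ℕ) i → f i ≤ maxFin f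
≤-maxFin f i = subst (f i ≤_) (sym (foldr-map-allFin _⊔_ 0 f)) (≤-foldr-⊔ f i)

module RootedTreeProperties (T : RootedTree) where
  open RootedTree T

  descF-fuel : ∀ f g (y : Node T) x → suc (toℕ y) ≤ f → suc (toℕ y) ≤ g →
               descF T f y x ≡ descF T g y x
  descF-fuel (suc f) (suc g) zero    x _       _       = refl
  descF-fuel (suc f) (suc g) (suc i) x (s≤s p) (s≤s q) =
    cong (eqᵇ (suc i) x ∨_)
         (descF-fuel f g (par i) x (≤-trans (s≤s (par-lt i)) p) (≤-trans (s≤s (par-lt i)) q))

  isDesc-suc : ∀ i x → isDesc T (suc i) x ≡ (eqᵇ (suc i) x ∨ isDesc T (par i) x)
  isDesc-suc i x =
    cong (eqᵇ (suc i) x ∨_) (descF-fuel _ _ (par i) x (s≤s (par-lt i)) ≤-refl)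

  isDesc-refl : ∀ x → isDesc T x x ≡ true
  isDesc-refl zero    = refl
  isDesc-refl (suc i) rewrite eqᵇ-refl (suc i) = refl

  descF-root : ∀ f (y : Node T) → suc (toℕ y) ≤ f → descF T f y zero ≡ true
  descF-root (suc f) zero    _       = refl
  descF-root (suc f) (suc i) (s≤s p) = descF-root f (par i) (≤-trans (s≤s (par-lt i)) p)

  isDesc-root : ∀ y → isDesc T y zero ≡ true
  isDesc-root y = descF-root _ y ≤-refl

  descF⇒≤ : ∀ f (y x : Node T) → descF T f y x ≡ true → toℕ x ≤ toℕ y
  descF⇒≤ (suc f) zero    x h rewrite sym (eqᵇ-sound {x = zero} {x} h) = z≤n
  descF⇒≤ (suc f) (suc i) x h with eqᵇ (suc i) x in e
  ... | true rewrite sym (eqᵇ-sound e) = ≤-refl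
  ... | false = ≤-trans (descF⇒≤ f (par i) x h) (≤-trans (par-lt i) (n≤1+n _))

  isDesc⇒≤ : ∀ {y x} → isDesc T y x ≡ true → toℕ x ≤ toℕ y
  isDesc⇒≤ {y} {x} = descF⇒≤ (suc (toℕ y)) y x

  isDesc-antisym : ∀ {x y} → isDesc T y x ≡ true → isDesc T x y ≡ true → x ≡ y
  isDesc-antisym y≼x x≼y = toℕ-injective (≤-antisym (isDesc⇒≤ y≼x) (isDesc⇒≤ x≼y))

  isDesc-< : ∀ {y x} → toℕ y < toℕ x → isDesc T y x ≡ false
  isDesc-< {y} {x} y<x with isDesc T y x in e
  ... | true  = ⊥-elim (<⇒≱ y<x (isDesc⇒≤ e))
  ... | false = refl

  par-not-desc : ∀ i → isDesc T (par i) (suc i) ≡ false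
  par-not-desc i = isDesc-< (s≤s (par-lt i))

  walk-start : ∀ {S x y} → TWalk T S x y → S x ≡ true
  walk-start (tnil s)      = s
  walk-start (tcons s _ _) = s

  -- A walk can only leave the subtree of suc i through the edge to par i.
  walk-leaves-subtree : ∀ {S x y} i → TWalk T S x y →
    isDesc T x (suc i) ≡ true → isDesc T y (suc i) ≡ false →
    S (suc i) ≡ true × S (par i) ≡ true
  walk-leaves-subtree i (tnil s) x≼ y⋠ with trans (sym x≼) y⋠
  ... | ()
  walk-leaves-subtree i (tcons {y = x′} s step w) x≼ y⋠ with isDesc T x′ (suc i) in x′≼
  ... | true = walk-leaves-subtree i w x′≼ y⋠
  walk-leaves-subtree i (tcons s (up j) w) x≼ y⋠ | false
    with eqᵇ-sound {x = suc j} {suc i} (∨-≡-trueˡ (trans (sym (isDesc-suc j (suc i))) x≼) x′≼)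
  ... | refl = s , walk-start w
  walk-leaves-subtree i (tcons s (down j) w) x≼ y⋠ | false
    with trans (sym (∨-≡-trueʳ (eqᵇ (suc j) (suc i)) x≼)) (trans (sym (isDesc-suc j (suc i))) x′≼)
  ... | ()

  isChild-unique : ∀ y → AtMostOne (isChild T y)
  isChild-unique (suc i) x x′ h h′ = trans (sym (eqᵇ-sound h)) (eqᵇ-sound h′)

  isChild-root : card (isChild T zero) ≡ 0
  isChild-root = sum-replicate-zero (suc m)

module TreeDecompositionProperties {G : Graph} (𝒯 : TreeDecomposition G) where
  open Graph G using (n; adj)
  open TreeDecomposition 𝒯
  open RootedTree tree
  open TD 𝒯
  open RootedTreeProperties tree

  mrg⇒bag : ∀ {x u} → mrg x u ≡ true → bag x u ≡ true
  mrg⇒bag = proj₁ ∘ ∧-≡-true⁻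

  adh-separates : ∀ {i u z w} → isDesc tree z (suc i) ≡ true → isDesc tree w (suc i) ≡ false →
                  bag z u ≡ true → bag w u ≡ true → adh (suc i) u ≡ true
  adh-separates {i} {u} {z} {w} z≼ w⋠ bzu bwu
    with walk-leaves-subtree i (proj₂ (vertex-subtree u) z w bzu bwu) z≼ w⋠
  ... | bsu , bpu = ∧-≡-true⁺ bpu bsu

  mrg-topmost : ∀ {x u w} → mrg x u ≡ true → bag w u ≡ true → isDesc tree w x ≡ true
  mrg-topmost {zero}  {w = w} _  _   = isDesc-root w
  mrg-topmost {suc i} {w = w} mu bwu with isDesc tree w (suc i) in w≼
  ... | true  = refl
  ... | false = ⊥-elim (∧-not-≡-true mu (adh-separates (isDesc-refl (suc i)) w≼ (mrg⇒bag mu) bwu))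

  mrg-unique : ∀ u → AtMostOne (λ x → mrg x u)
  mrg-unique u x y mx my =
    isDesc-antisym (mrg-topmost mx (mrg⇒bag my)) (mrg-topmost my (mrg⇒bag mx))

  -- The edge uw lies in some bag t.  If t is outside the subtree of suc i, then
  -- w ∈ adh (suc i), contradicting w ∈ comp (suc i); so t is inside, and u
  -- reaches it from bag (par i).
  nbr-in-comp⇒adh : ∀ {i u w} → bag (par i) u ≡ true → adj u w ≡ true →
                    comp (suc i) w ≡ true → adh (suc i) u ≡ true
  nbr-in-comp⇒adh {i} {u} {w} bpu uw cw
    with any-witness (λ z → isDesc tree z (suc i) ∧ bag z w) (allFin (suc m)) (proj₁ (∧-≡-true⁻ cw))
       | edge-covered u w uw
  ... | z , z≼∧bzw | t , btu , btw with ∧-≡-true⁻ {isDesc tree z (suc i)} z≼∧bzw | isDesc tree t (suc i) in t≼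
  ... | _       , _   | true  = adh-separates t≼ (par-not-desc i) btu bpu
  ... | z≼ , bzw | false = ⊥-elim (∧-not-≡-true cw (adh-separates z≼ t≼ bzw btw))

  bgraph-child-edge⇒adh : ∀ x y u → bag x u ∧ isChild tree y x ∧ hasNbrIn u (comp y) ≡ true →
                          isChild tree y x ∧ adh y u ≡ true
  bgraph-child-edge⇒adh x zero u h
    with ∧-≡-true⁻ {isChild tree zero x} {hasNbrIn u (comp zero)} (proj₂ (∧-≡-true⁻ {bag x u} h))
  ... | () , _
  bgraph-child-edge⇒adh x (suc i) u h with ∧-≡-true⁻ {bag x u} h
  ... | bxu , h′ with ∧-≡-true⁻ {isChild tree (suc i) x} h′
  ... | y◁x , nbr with eqᵇ-sound {x = par i} {x} y◁x
  ... | refl with any-witness _ (allFin n) nbr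
  ... | w , uw∧cw with ∧-≡-true⁻ {adj u w} uw∧cw
  ... | uw , cw = ∧-≡-true⁺ y◁x (nbr-in-comp⇒adh bxu uw cw)

  children : Node tree → ℕ
  children x = card (λ y → isChild tree y x)

  card-adh≤adhesion : ∀ x → card (adh x) ≤ adhesion
  card-adh≤adhesion x = subst (_≤ adhesion) (count≡card (adh x)) (≤-maxFin (λ x → count (adh x)) x)

  card-adh-root : card (adh zero) ≡ 0
  card-adh-root = sum-replicate-zero n

  open ≤-Reasoning

  sum-card-mrg≤ : ∑[ x < suc m ] card (mrg x) ≤ n
  sum-card-mrg≤ = begin
    ∑[ x < suc m ] card (mrg x)          ≡⟨ ∑-comm (λ x u → 𝟙 (mrg x u)) ⟩
    ∑[ u < n ] card (λ x → mrg x u)      ≤⟨ sum-≤-* (λ u → card-≤1 (mrg-unique u)) ⟩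
    n * 1                                ≡⟨ *-identityʳ n ⟩
    n                                    ∎

  sum-card-adh≤ : ∑[ x < suc m ] card (adh x) ≤ m * adhesion
  sum-card-adh≤ = sum-≤-pred-* (λ x → card (adh x)) card-adh-root (λ i → card-adh≤adhesion (suc i))

  sum-card-children≤ : ∑[ x < suc m ] children x ≤ m
  sum-card-children≤ = begin
    ∑[ x < suc m ] children x
      ≡⟨ ∑-comm (λ x y → 𝟙 (isChild tree y x)) ⟩
    ∑[ y < suc m ] card (isChild tree y)
      ≤⟨ sum-≤-pred-* (λ y → card (isChild tree y)) isChild-root (λ i → card-≤1 (isChild-unique (suc i))) ⟩
    m * 1
      ≡⟨ *-identityʳ m ⟩
    m
      ∎

  card-bag≤ : ∀ x → card (bag x) ≤ card (mrg x) + card (adh x)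
  card-bag≤ x = sum-≤-+ (λ u → 𝟙-∧-not-split (bag x u) (adh x u))

  nodes≤vertices : Regular → m ≤ n
  nodes≤vertices R = begin
    m
      ≡⟨ *-identityʳ m ⟨
    m * 1
      ≤⟨ *-≤-sum {f = λ i → card (mrg (suc i))} (λ i → card-nonempty {p = mrg (suc i)} (proj₂ (proj₁ (R i)))) ⟩
    ∑[ i < m ] card (mrg (suc i))
      ≤⟨ m≤n+m _ (card (mrg zero)) ⟩
    ∑[ x < suc m ] card (mrg x)
      ≤⟨ sum-card-mrg≤ ⟩
    n
      ∎

  sumFin-bgOrder≤ : sumFin bgOrder ≤ n + m * adhesion + m
  sumFin-bgOrder≤ = begin
    sumFin bgOrder
      ≡⟨ sumFin≡sum bgOrder ⟩
    ∑[ x < suc m ] (count (bag x) + count (λ y → isChild tree y x))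
      ≡⟨ sum-cong-≗ (λ x → cong₂ _+_ (count≡card (bag x)) (count≡card (λ y → isChild tree y x))) ⟩
    ∑[ x < suc m ] (card (bag x) + children x)
      ≤⟨ sum-≤-+₃ {g = λ x → card (mrg x)} {λ x → card (adh x)} {children}
                  (λ x → +-monoˡ-≤ (children x) (card-bag≤ x)) ⟩
    ∑[ x < suc m ] card (mrg x) + ∑[ x < suc m ] card (adh x) + ∑[ x < suc m ] children x
      ≤⟨ +-monoʳ-≤ _ sum-card-children≤ ⟩
    ∑[ x < suc m ] card (mrg x) + ∑[ x < suc m ] card (adh x) + m
      ≤⟨ +-monoˡ-≤ m (+-mono-≤ sum-card-mrg≤ sum-card-adh≤) ⟩
    n + m * adhesion + m
      ∎

  forward : Fin n → Fin n → Bool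
  forward u v = ltᵇ u v ∧ adj u v

  bag-edges child-edges mrg-edges : Node tree → ℕ
  bag-edges   x = ∑[ u < n ] card (λ v → bag x u ∧ bag x v ∧ forward u v)
  child-edges x = ∑[ u < n ] card (λ y → bag x u ∧ isChild tree y x ∧ hasNbrIn u (comp y))
  mrg-edges   x = ∑[ u < n ] card (λ v → mrg x u ∧ forward u v)

  bgEdges≡ : ∀ x → bgEdges x ≡ bag-edges x + child-edges x
  bgEdges≡ x = cong₂ _+_ (sumFin-count≡sum-card (λ u v → bag x u ∧ bag x v ∧ forward u v))
                         (sumFin-count≡sum-card (λ u y → bag x u ∧ isChild tree y x ∧ hasNbrIn u (comp y)))

  bag-edges≤ : ∀ x → bag-edges x ≤ mrg-edges x + card (adh x) * card (mrg x) + card (adh x) * card (adh x)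
  bag-edges≤ x = begin
    bag-edges x
      ≤⟨ sum-≤-+₃ (λ u → sum-≤-+₃ (λ v → split (bag x u) (bag x v) (adh x u) (adh x v) (forward u v))) ⟩
    mrg-edges x + ∑[ u < n ] ∑[ v < n ] 𝟙 (adh x u ∧ mrg x v) + ∑[ u < n ] ∑[ v < n ] 𝟙 (adh x u ∧ adh x v)
      ≡⟨ cong₂ _+_ (cong (mrg-edges x +_) (card-× (adh x) (mrg x))) (card-× (adh x) (adh x)) ⟩
    mrg-edges x + card (adh x) * card (mrg x) + card (adh x) * card (adh x)
      ∎
    where
    split : ∀ bu bv au av e →
            𝟙 (bu ∧ bv ∧ e) ≤ 𝟙 ((bu ∧ not au) ∧ e) + 𝟙 (au ∧ (bv ∧ not av)) + 𝟙 (au ∧ av)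
    split false bv    au    av    e     = z≤n
    split true  false au    av    e     = z≤n
    split true  true  au    av    false = z≤n
    split true  true  false av    true  = ≤-refl
    split true  true  true  false true  = ≤-refl
    split true  true  true  true  true  = ≤-refl

  sum-mrg-edges≤ : ∑[ x < suc m ] mrg-edges x ≤ edgeCount G
  sum-mrg-edges≤ = begin
    ∑[ x < suc m ] mrg-edges x
      ≡⟨ ∑-comm (λ x u → card (λ v → mrg x u ∧ forward u v)) ⟩
    ∑[ u < n ] ∑[ x < suc m ] card (λ v → mrg x u ∧ forward u v)
      ≡⟨ sum-cong-≗ (λ u → card-× (λ x → mrg x u) (forward u)) ⟩
    ∑[ u < n ] (card (λ x → mrg x u) * card (forward u))
      ≤⟨ sum-mono-≤ (λ u → card-≤1-* (mrg-unique u)) ⟩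
    ∑[ u < n ] card (forward u)
      ≡⟨ sumFin-count≡sum-card forward ⟨
    edgeCount G
      ∎

  sum-adh-mrg≤ : ∑[ x < suc m ] (card (adh x) * card (mrg x)) ≤ adhesion * n
  sum-adh-mrg≤ = begin
    ∑[ x < suc m ] (card (adh x) * card (mrg x))  ≤⟨ sum-mono-≤ (λ x → *-monoˡ-≤ (card (mrg x)) (card-adh≤adhesion x)) ⟩
    ∑[ x < suc m ] (adhesion * card (mrg x))      ≡⟨ *-distribˡ-sum adhesion (λ x → card (mrg x)) ⟨
    adhesion * ∑[ x < suc m ] card (mrg x)        ≤⟨ *-monoʳ-≤ adhesion sum-card-mrg≤ ⟩
    adhesion * n                                  ∎

  sum-adh-adh≤ : ∑[ x < suc m ] (card (adh x) * card (adh x)) ≤ m * (adhesion * adhesion)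
  sum-adh-adh≤ = sum-≤-pred-* (λ x → card (adh x) * card (adh x)) (cong (λ k → k * k) card-adh-root)
                              (λ i → *-mono-≤ (card-adh≤adhesion (suc i)) (card-adh≤adhesion (suc i)))

  sum-child-edges≤ : ∑[ x < suc m ] child-edges x ≤ m * adhesion
  sum-child-edges≤ = begin
    ∑[ x < suc m ] child-edges x
      ≤⟨ sum-mono-≤ (λ x → sum-mono-≤ (λ u → sum-mono-≤ (λ y → 𝟙-mono (bgraph-child-edge⇒adh x y u)))) ⟩
    ∑[ x < suc m ] ∑[ u < n ] ∑[ y < suc m ] 𝟙 (isChild tree y x ∧ adh y u)
      ≡⟨ sum-cong-≗ (λ x → ∑-comm (λ u y → 𝟙 (isChild tree y x ∧ adh y u))) ⟩
    ∑[ x < suc m ] ∑[ y < suc m ] ∑[ u < n ] 𝟙 (isChild tree y x ∧ adh y u)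
      ≡⟨ ∑-comm (λ x y → card (λ u → isChild tree y x ∧ adh y u)) ⟩
    ∑[ y < suc m ] ∑[ x < suc m ] ∑[ u < n ] 𝟙 (isChild tree y x ∧ adh y u)
      ≡⟨ sum-cong-≗ (λ y → card-× (isChild tree y) (adh y)) ⟩
    ∑[ y < suc m ] (card (isChild tree y) * card (adh y))
      ≤⟨ sum-≤-pred-* (λ y → card (isChild tree y) * card (adh y)) (cong (_* card (adh zero)) isChild-root)
                      (λ i → ≤-trans (card-≤1-* (isChild-unique (suc i))) (card-adh≤adhesion (suc i))) ⟩
    m * adhesion
      ∎

  sumFin-bgEdges≤ : sumFin bgEdges ≤ edgeCount G + adhesion * n + m * (adhesion * adhesion) + m * adhesion
  sumFin-bgEdges≤ = begin
    sumFin bgEdges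
      ≡⟨ trans (sumFin≡sum bgEdges) (sum-cong-≗ bgEdges≡) ⟩
    ∑[ x < suc m ] (bag-edges x + child-edges x)
      ≤⟨ sum-≤-+ {g = λ x → mrg-edges x + card (adh x) * card (mrg x) + card (adh x) * card (adh x)}
                 {h = child-edges} (λ x → +-monoˡ-≤ (child-edges x) (bag-edges≤ x)) ⟩
    ∑[ x < suc m ] (mrg-edges x + card (adh x) * card (mrg x) + card (adh x) * card (adh x))
      + ∑[ x < suc m ] child-edges x
      ≤⟨ +-mono-≤ (≤-reflexive (∑-distrib-+₃ mrg-edges (λ x → card (adh x) * card (mrg x))
                                                     (λ x → card (adh x) * card (adh x))))
                  sum-child-edges≤ ⟩
    ∑[ x < suc m ] mrg-edges x + ∑[ x < suc m ] (card (adh x) * card (mrg x))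
      + ∑[ x < suc m ] (card (adh x) * card (adh x)) + m * adhesion
      ≤⟨ +-monoˡ-≤ (m * adhesion) (+-mono-≤ (+-mono-≤ sum-mrg-edges≤ sum-adh-mrg≤) sum-adh-adh≤) ⟩
    edgeCount G + adhesion * n + m * (adhesion * adhesion) + m * adhesion
      ∎

open +-*-Solver using (solve; _:=_; _:+_; _:*_; con)

order-arith : ∀ a {m n} → m ≤ n → n + m * a + m ≤ (a + 2) * n
order-arith a {m} {n} m≤n = ≤-trans
  (+-mono-≤ (+-monoʳ-≤ n (*-monoˡ-≤ a m≤n)) m≤n)
  (≤-reflexive (solve 2 (λ a n → n :+ n :* a :+ n := (a :+ con 2) :* n) refl a n))

size-arith : ∀ a e {m n} → m ≤ n →
  (a + 2) * n + (e + a * n + m * (a * a) + m * a) ≤ n + e + (a + 2) * (a + 2) * n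
size-arith a e {m} {n} m≤n = ≤-trans
  (+-monoʳ-≤ ((a + 2) * n) (+-mono-≤ (+-monoʳ-≤ (e + a * n) (*-monoˡ-≤ (a * a) m≤n)) (*-monoˡ-≤ a m≤n)))
  (≤-trans (m≤m+n _ (a * n + 3 * n))
    (≤-reflexive (solve 3 (λ a n e → (a :+ con 2) :* n :+ (e :+ a :* n :+ n :* (a :* a) :+ n :* a)
                                       :+ (a :* n :+ con 3 :* n)
                                     := n :+ e :+ (a :+ con 2) :* (a :+ con 2) :* n) refl a n e)))

lemma3p4 : (G : Graph) (𝒯 : TreeDecomposition G) (a : ℕ) →
    TD.Regular 𝒯 → TD.adhesion 𝒯 ≡ a →
    (sumFin (TD.bgOrder 𝒯) ≤ (a + 2) * order G)
    × (sumFin (TD.bgSize 𝒯) ≤ size G + (a + 2) * (a + 2) * order G)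
lemma3p4 G 𝒯 ._ R refl = order-bound , size-bound
  where
  open TD 𝒯
  open TreeDecompositionProperties 𝒯
  open RootedTree (TreeDecomposition.tree 𝒯) using (m)
  open ≤-Reasoning
  n a : ℕ
  n = order G
  a = adhesion

  m≤n : m ≤ n
  m≤n = nodes≤vertices R

  order-bound : sumFin bgOrder ≤ (a + 2) * n
  order-bound = ≤-trans sumFin-bgOrder≤ (order-arith a m≤n)

  size-bound : sumFin bgSize ≤ size G + (a + 2) * (a + 2) * n
  size-bound = begin
    sumFin bgSize                    ≡⟨ sumFin-+ bgOrder bgEdges ⟩
    sumFin bgOrder + sumFin bgEdges  ≤⟨ +-mono-≤ order-bound sumFin-bgEdges≤ ⟩
    (a + 2) * n + (edgeCount G + a * n + m * (a * a) + m * a)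
                                     ≤⟨ size-arith a (edgeCount G) m≤n ⟩
    size G + (a + 2) * (a + 2) * n   ∎
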